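{- Let $\mathcal{W}=\{n\in\mathbb{N}_0:\ p\mid n \text{ implies } p^2\mid n \text{ for every prime } p\}$ denote the set of squareful integers. Let $F_2(N)$ denote the largest dimension $d$ such that there exist a non-negative integer $a_0$ and positive integers $a_1,\dots,a_d$ with $\mathcal{H}(a_0;a_1,\dots,a_d)\subset\mathcal{W}\cap[1,N]$. Then $F_2(N)\ll\log N$.
   Context: The Hilbert cube is $\mathcal{H}(a_0;a_1,\dots,a_d)=\{a_0+\sum_{i\in I}a_i:\ I\subseteq\{1,\dots,d\}\}$. $\mathbb{N}_0$ denotes the non-negative integers. $X\ll Y$ means $X\le CY$ for an absolute constant $C$ (for all sufficiently large $N$). -}

module Defs where

open import Data.Nat using (ℕ; zero; suc; _+_; _*_; _≤_)
open import Data.Nat.Divisibility using (_∣_)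
open import Data.Nat.Primality using (Prime)
open import Data.Bool using (Bool; true; false)
open import Data.Fin using (Fin; zero; suc)
open import Data.Vec using (_∷_; [])
open import Data.Fin.Subset using (Subset)
open import Data.Product using (_×_)

Squareful : ℕ → Set
Squareful n = ∀ p → Prime p → p ∣ n → p * p ∣ n

subsetSum : ∀ {d} → (Fin d → ℕ) → Subset d → ℕ
subsetSum {zero}  a []          = 0
subsetSum {suc d} a (true  ∷ I) = a zero + subsetSum (λ i → a (suc i)) I
subsetSum {suc d} a (false ∷ I) = subsetSum (λ i → a (suc i)) I

cubeElem : ∀ {d} → ℕ → (Fin d → ℕ) → Subset d → ℕ
cubeElem a0 a I = a0 + subsetSum a I

CubeInSquarefulUpTo : ℕ → ∀ {d} → ℕ → (Fin d → ℕ) → Set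
CubeInSquarefulUpTo N a0 a =
  ∀ I → Squareful (cubeElem a0 a I) × (1 ≤ cubeElem a0 a I) × (cubeElem a0 a I ≤ N)

{-# OPTIONS --safe #-}
-- Fix a prime q and suppose 2q − 1 generators x₁ … x_{q−1}, y, z₁ … z_{q−1} of a cube
-- whose elements are all squareful are prime to q. Subset sums of q − 1 non-multiples
-- of q meet every residue class mod q (they grow by at least one class per element, or
-- are closed under a translation generating ℤ/q). Hence the x's complete any sum u of
-- the y, z's to a cube element divisible by q, so by q², and two such sums that agree
-- mod q agree mod q². Taking a z-sum F r ≡ r (mod q) for every r, this gives
-- F (y + r) ≡ y + F r, so F (q y) ≡ F 0 + q y, but also F (q y) ≡ F 0, mod q²: q ∣ y.
-- So at most 2(q − 1) generators are prime to q.
--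
-- With P the product of the primes up to M, each generator aᵢ ≤ N satisfies
-- P ≤ aᵢ · ∏_{p ≤ M, p ∤ aᵢ} p; multiplying over i, P^d ≤ N^d P^{2M}, so d ≤ 4M as soon
-- as N² ≤ P. Chebyshev's bound log P ≫ M, obtained from 2^k ≤ lcm (1, …, 2k + 1)
-- (Leibniz's harmonic triangle) and lcm (1, …, B²) ≤ P (B²)^B, lets M ≪ log N.
module Submission where

open import Defs
open import Data.Bool using (true; false; if_then_else_)
open import Data.Empty using (⊥-elim)
open import Data.Fin using (Fin; zero; suc; toℕ; _↑ˡ_; _↑ʳ_)
open import Data.Fin.Properties using (any?; toℕ-fromℕ<)
open import Data.Fin.Subset using (Subset; ∣_∣; _∈_; _⊂_; ⁅_⁆; ⊤) renaming (⊥ to ∅)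
open import Data.Fin.Subset.Properties
  using (anySubset?; ∈⊤; ∣p∣≤n; ∣p∣≡n⇒p≡⊤; p⊂q⇒∣p∣<∣q∣; x∈p⇒∣p-x∣<∣p∣)
open import Data.List using ([]; _∷_)
open import Data.List.Relation.Unary.All using ([]; _∷_)
open import Data.Nat
open import Data.Nat.Coprimality using (Coprime; coprime-Bézout; coprime-divisor)
open import Data.Nat.DivMod
open import Data.Nat.Divisibility
open import Data.Nat.GCD using (module Bézout)
open import Data.Nat.Induction using (<-rec)
open import Data.Nat.ListAction using (product)
open import Data.Nat.Logarithm using (⌊log₂_⌋; ⌊log₂⌋-mono-≤; ⌊log₂[2^n]⌋≡n)
open import Data.Nat.Primality
open import Data.Nat.Primality.Factorisation using (factorise)
open import Data.Nat.Properties
open import Algebra.Properties.CommutativeSemigroup +-commutativeSemigroup using (x∙yz≈y∙xz)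
open import Algebra.Properties.CommutativeSemigroup *-commutativeSemigroup
  using () renaming (interchange to *-interchange)
open import Data.Nat.Tactic.RingSolver using (solve-∀)
open import Data.Product using (Σ; ∃; _×_; _,_; proj₁; proj₂)
open import Data.Sum using (_⊎_; inj₁; inj₂)
open import Data.Vec using ([]; _∷_; _++_; tabulate)
open import Data.Vec.Functional using () renaming (_∷_ to _∷ᶠ_)
open import Data.Vec.Properties using (lookup∘tabulate; []=⇒lookup; lookup⇒[]=)
open import Function using (_∘_)
open import Level using (0ℓ)
open import Relation.Binary.Bundles using (Setoid)
open import Relation.Binary.PropositionalEquality
import Relation.Binary.Reasoning.Setoid as ≈-Reasoning
open import Relation.Binary.Structures using (IsEquivalence)
open import Relation.Nullary using (¬_; Dec; yes; no; does; contradiction)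
open import Relation.Nullary.Decidable using (_×-dec_; ¬?; dec-true; map′)

-- Congruences

-- A record rather than a synonym for a % q ≡ b % q, so that a and b can be inferred.
infix 4 _≡_[mod_]
record _≡_[mod_] (a b q : ℕ) .{{_ : NonZero q}} : Set where
  constructor mod≡
  field %-≡ : a % q ≡ b % q
open _≡_[mod_]

module _ {q : ℕ} .{{_ : NonZero q}} where

  ≡-mod-isEquivalence : IsEquivalence (λ a b → a ≡ b [mod q ])
  ≡-mod-isEquivalence = record
    { refl  = mod≡ refl
    ; sym   = λ (mod≡ p) → mod≡ (sym p)
    ; trans = λ (mod≡ p) (mod≡ p′) → mod≡ (trans p p′)
    }

  ≡-mod-setoid : Setoid 0ℓ 0ℓ
  ≡-mod-setoid = record { isEquivalence = ≡-mod-isEquivalence }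

  open IsEquivalence ≡-mod-isEquivalence public
    using () renaming (refl to ≡-mod-refl; sym to ≡-mod-sym; trans to ≡-mod-trans)

  ≡⇒≡-mod : ∀ {a b} → a ≡ b → a ≡ b [mod q ]
  ≡⇒≡-mod a≡b = mod≡ (cong (_% q) a≡b)

  %-≡-mod : ∀ a → a % q ≡ a [mod q ]
  %-≡-mod a = mod≡ (m%n%n≡m%n a q)

  ≡-mod? : ∀ a b → Dec (a ≡ b [mod q ])
  ≡-mod? a b = map′ mod≡ %-≡ (a % q ≟ b % q)

  ∣∧∣⇒≡-mod : ∀ {a b} → q ∣ a → q ∣ b → a ≡ b [mod q ]
  ∣∧∣⇒≡-mod {a} {b} q∣a q∣b = mod≡ (trans (n∣m⇒m%n≡0 a q q∣a) (sym (n∣m⇒m%n≡0 b q q∣b)))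

  ∣-resp-≡-mod : ∀ {a b} → a ≡ b [mod q ] → q ∣ b → q ∣ a
  ∣-resp-≡-mod {a} {b} (mod≡ a≡b) q∣b = m%n≡0⇒n∣m a q (trans a≡b (n∣m⇒m%n≡0 b q q∣b))

  +-cong-mod : ∀ {a a′ b b′} →
    a ≡ a′ [mod q ] → b ≡ b′ [mod q ] → a + b ≡ a′ + b′ [mod q ]
  +-cong-mod {a} {a′} {b} {b′} (mod≡ a≡a′) (mod≡ b≡b′) = mod≡ (begin
    (a + b) % q           ≡⟨ %-distribˡ-+ a b q ⟩
    (a % q + b % q) % q   ≡⟨ cong₂ (λ s t → (s + t) % q) a≡a′ b≡b′ ⟩
    (a′ % q + b′ % q) % q ≡⟨ %-distribˡ-+ a′ b′ q ⟨
    (a′ + b′) % q         ∎)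
    where open ≡-Reasoning

  *-cong-mod : ∀ {a a′ b b′} →
    a ≡ a′ [mod q ] → b ≡ b′ [mod q ] → a * b ≡ a′ * b′ [mod q ]
  *-cong-mod {a} {a′} {b} {b′} (mod≡ a≡a′) (mod≡ b≡b′) = mod≡ (begin
    (a * b) % q             ≡⟨ %-distribˡ-* a b q ⟩
    (a % q * (b % q)) % q   ≡⟨ cong₂ (λ s t → (s * t) % q) a≡a′ b≡b′ ⟩
    (a′ % q * (b′ % q)) % q ≡⟨ %-distribˡ-* a′ b′ q ⟨
    (a′ * b′) % q           ∎)
    where open ≡-Reasoning

  ∃-+-inverse-mod : ∀ c → ∃ λ e → q ∣ e + c
  ∃-+-inverse-mod c = q ∸ c % q , ∣-resp-≡-mod e+c≡q ∣-refl
    where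
    e+c≡q : q ∸ c % q + c ≡ q [mod q ]
    e+c≡q = ≡-mod-trans (+-cong-mod ≡-mod-refl (≡-mod-sym (%-≡-mod c)))
                        (≡⇒≡-mod (m∸n+n≡m (m%n≤n c q)))

  +-cancelˡ-mod : ∀ c {a b} → c + a ≡ c + b [mod q ] → a ≡ b [mod q ]
  +-cancelˡ-mod c {a} {b} c+a≡c+b =
    ≡-mod-trans (≡-mod-sym (cancel a))
                (≡-mod-trans (+-cong-mod (≡-mod-refl {x = e}) c+a≡c+b) (cancel b))
    where
    e = proj₁ (∃-+-inverse-mod c)
    cancel : ∀ x → e + (c + x) ≡ x [mod q ]
    cancel x = mod≡ (trans (cong (_% q) (sym (+-assoc e c x)))
                           (%-remove-+ˡ x (proj₂ (∃-+-inverse-mod c))))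

-- Subset sums

subsetSum-∅ : ∀ {n} (g : Fin n → ℕ) → subsetSum g ∅ ≡ 0
subsetSum-∅ {zero} g = refl
subsetSum-∅ {suc n} g = subsetSum-∅ (g ∘ suc)

subsetSum-⁅⁆ : ∀ {n} (g : Fin n → ℕ) i → subsetSum g ⁅ i ⁆ ≡ g i
subsetSum-⁅⁆ g zero = trans (cong (g zero +_) (subsetSum-∅ (g ∘ suc))) (+-identityʳ (g zero))
subsetSum-⁅⁆ g (suc i) = subsetSum-⁅⁆ (g ∘ suc) i

subsetSum-++ : ∀ {m n} (g : Fin (m + n) → ℕ) (S : Subset m) (T : Subset n) →
  subsetSum g (S ++ T) ≡ subsetSum (g ∘ (_↑ˡ n)) S + subsetSum (g ∘ (m ↑ʳ_)) T
subsetSum-++ {zero} g [] T = refl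
subsetSum-++ {suc m} g (true ∷ S) T =
  trans (cong (g zero +_) (subsetSum-++ (g ∘ suc) S T)) (sym (+-assoc (g zero) _ _))
subsetSum-++ {suc m} g (false ∷ S) T = subsetSum-++ (g ∘ suc) S T

infix 4 _⊑_
_⊑_ : ∀ {m n} → (Fin m → ℕ) → (Fin n → ℕ) → Set
h ⊑ g = ∀ J → ∃ λ I → subsetSum g I ≡ subsetSum h J

⊑-cube : ∀ {m n} {h : Fin m → ℕ} {g : Fin n → ℕ} (P : ℕ → Set) a₀ → h ⊑ g →
  (∀ I → P (a₀ + subsetSum g I)) → ∀ J → P (a₀ + subsetSum h J)
⊑-cube P a₀ h⊑g cube J with h⊑g J
... | I , eq = subst (λ s → P (a₀ + s)) eq (cube I)

↑ˡ-⊑ : ∀ {m} n (g : Fin (m + n) → ℕ) → g ∘ (_↑ˡ n) ⊑ g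
↑ˡ-⊑ {m} n g J = J ++ ∅ , (begin
  subsetSum g (J ++ ∅)                   ≡⟨ subsetSum-++ g J ∅ ⟩
  subsetSum h J + subsetSum (g ∘ (m ↑ʳ_)) ∅ ≡⟨ cong (subsetSum h J +_) (subsetSum-∅ (g ∘ (m ↑ʳ_))) ⟩
  subsetSum h J + 0                      ≡⟨ +-identityʳ _ ⟩
  subsetSum h J                          ∎)
  where
  open ≡-Reasoning
  h = g ∘ (_↑ˡ n)

#nonMultiples : ∀ {d} → ℕ → (Fin d → ℕ) → ℕ
#nonMultiples {zero} q a = 0
#nonMultiples {suc d} q a with q ∣? a zero
... | yes _ = #nonMultiples q (a ∘ suc)
... | no _  = suc (#nonMultiples q (a ∘ suc))

nonMultiples : ∀ {d} q (a : Fin d → ℕ) →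
  Σ (Fin (#nonMultiples q a) → ℕ) λ g → (∀ i → ¬ q ∣ g i) × g ⊑ a
nonMultiples {zero} q a = (λ ()) , (λ ()) , λ { [] → [] , refl }
nonMultiples {suc d} q a with q ∣? a zero | nonMultiples q (a ∘ suc)
... | yes _ | g , g∤ , g⊑a = g , g∤ , λ J → let I , eq = g⊑a J in false ∷ I , eq
... | no a₀∤ | g , g∤ , g⊑a = a zero ∷ᶠ g , ∷-∤ , ∷-⊑
  where
  ∷-∤ : ∀ i → ¬ q ∣ (a zero ∷ᶠ g) i
  ∷-∤ zero = a₀∤
  ∷-∤ (suc i) = g∤ i
  ∷-⊑ : a zero ∷ᶠ g ⊑ a
  ∷-⊑ (b ∷ J) with g⊑a J
  ∷-⊑ (true ∷ J)  | I , eq = true ∷ I , cong (a zero +_) eq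
  ∷-⊑ (false ∷ J) | I , eq = false ∷ I , eq

-- Cubes squareful at a prime

SquarefulAt : ℕ → ℕ → Set
SquarefulAt p n = p ∣ n → p * p ∣ n

module _ {k : ℕ} (q-prime : Prime (suc k)) where

  private
    q = suc k

  prime∤⇒coprime : ∀ {x} → ¬ q ∣ x → Coprime q x
  prime∤⇒coprime q∤x (d∣q , d∣x) with prime⇒irreducible q-prime d∣q
  ... | inj₁ d≡1 = d≡1
  ... | inj₂ refl = contradiction d∣x q∤x

  ∃-*-inverse-mod : ∀ {x} → ¬ q ∣ x → ∃ λ t → t * x ≡ 1 [mod q ]
  ∃-*-inverse-mod {x} q∤x with coprime-Bézout (prime∤⇒coprime q∤x)
  ... | Bézout.-+ a b 1+aq≡bx = b , mod≡ (trans (cong (_% q) (sym 1+aq≡bx)) ([m+kn]%n≡m%n 1 a q))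
  -- b x ≡ −1, so k b x ≡ −k ≡ 1 as q = k + 1.
  ... | Bézout.+- a b 1+bx≡aq =
    k * b , +-cancelˡ-mod k (∣∧∣⇒≡-mod q∣k+kbx (subst (q ∣_) (+-comm 1 k) ∣-refl))
    where
    q∣k+kbx : q ∣ k + k * b * x
    q∣k+kbx = divides (k * a) (begin
      k + k * b * x       ≡⟨ cong (k +_) (*-assoc k b x) ⟩
      k + k * (b * x)     ≡⟨ cong (_+ k * (b * x)) (*-identityʳ k) ⟨
      k * 1 + k * (b * x) ≡⟨ *-distribˡ-+ k 1 (b * x) ⟨
      k * (1 + b * x)     ≡⟨ cong (k *_) 1+bx≡aq ⟩
      k * (a * q)         ≡⟨ *-assoc k a q ⟨
      k * a * q           ∎)
      where open ≡-Reasoning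

  ∃-*-solution-mod : ∀ {x} → ¬ q ∣ x → ∀ r → ∃ λ t → t * x ≡ r [mod q ]
  ∃-*-solution-mod q∤x r with ∃-*-inverse-mod q∤x
  ... | t , tx≡1 = r * t , (begin
    r * t * _   ≡⟨ *-assoc r t _ ⟩
    r * (t * _) ≈⟨ *-cong-mod (≡-mod-refl {x = r}) tx≡1 ⟩
    r * 1       ≡⟨ *-identityʳ r ⟩
    r           ∎)
    where open ≈-Reasoning (≡-mod-setoid {q})

  Hits : ∀ {n} → (Fin n → ℕ) → ℕ → Set
  Hits g r = ∃ λ S → subsetSum g S ≡ r [mod q ]

  hits? : ∀ {n} (g : Fin n → ℕ) r → Dec (Hits g r)
  hits? g r = anySubset? (λ S → ≡-mod? (subsetSum g S) r)

  hits-cong : ∀ {n} {g : Fin n → ℕ} {r r′} → r ≡ r′ [mod q ] → Hits g r → Hits g r′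
  hits-cong r≡r′ (S , eq) = S , ≡-mod-trans eq r≡r′

  hits-0 : ∀ {n} (g : Fin n → ℕ) → Hits g 0
  hits-0 g = ∅ , ≡⇒≡-mod (subsetSum-∅ g)

  hits-tail : ∀ {n} {g : Fin (suc n) → ℕ} {r} → Hits (g ∘ suc) r → Hits g r
  hits-tail (S , eq) = false ∷ S , eq

  hits-head : ∀ {n} {g : Fin (suc n) → ℕ} {r} → Hits (g ∘ suc) r → Hits g (g zero + r)
  hits-head (S , eq) = true ∷ S , +-cong-mod ≡-mod-refl eq

  toℕ-mod : ∀ r → toℕ (r mod q) ≡ r [mod q ]
  toℕ-mod r = ≡-mod-trans (≡⇒≡-mod (toℕ-fromℕ< (m%n<n r q))) (%-≡-mod r)

  hitSet : ∀ {n} → (Fin n → ℕ) → Subset q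
  hitSet g = tabulate (λ i → does (hits? g (toℕ i)))

  ∈hitSet⁺ : ∀ {n} {g : Fin n → ℕ} {i} → Hits g (toℕ i) → i ∈ hitSet g
  ∈hitSet⁺ {g = g} {i} h = lookup⇒[]= i (hitSet g)
    (trans (lookup∘tabulate (λ j → does (hits? g (toℕ j))) i) (dec-true (hits? g (toℕ i)) h))

  ∈hitSet⁻ : ∀ {n} {g : Fin n → ℕ} {i} → i ∈ hitSet g → Hits g (toℕ i)
  ∈hitSet⁻ {g = g} {i} i∈ with hits? g (toℕ i)
                             | trans (sym (lookup∘tabulate (λ j → does (hits? g (toℕ j))) i))
                                     ([]=⇒lookup i∈)
  ... | yes h | _ = h
  ... | no _  | ()

  closed⇒hitsAll : ∀ {n} (g : Fin n → ℕ) {x} → ¬ q ∣ x →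
    (∀ r → Hits g r → Hits g (x + r)) → ∀ r → Hits g r
  closed⇒hitsAll g {x} q∤x closed r with ∃-*-solution-mod q∤x r
  ... | t , tx≡r = hits-cong tx≡r (multiples t)
    where
    multiples : ∀ t → Hits g (t * x)
    multiples zero = hits-0 g
    multiples (suc t) = closed (t * x) (multiples t)

  hitSet-grows : ∀ {n} (g : Fin n → ℕ) → (∀ i → ¬ q ∣ g i) →
    (∀ r → Hits g r) ⊎ n < ∣ hitSet g ∣
  hitSet-grows {zero} g _ =
    inj₂ (≤-trans (s≤s z≤n) (x∈p⇒∣p-x∣<∣p∣ (∈hitSet⁺ {i = zero} (hits-0 g))))
  hitSet-grows {suc n} g g∤ with hitSet-grows (g ∘ suc) (g∤ ∘ suc)
  ... | inj₁ hitsAll = inj₁ (hits-tail ∘ hitsAll)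
  ... | inj₂ n<∣tail∣
    with any? (λ i → hits? (g ∘ suc) (toℕ i) ×-dec ¬? (hits? (g ∘ suc) (g zero + toℕ i)))
  ... | yes (i , h , ¬h′) = inj₂ (≤-trans (s≤s n<∣tail∣) (p⊂q⇒∣p∣<∣q∣ tail⊂))
    where
    tail⊂ : hitSet (g ∘ suc) ⊂ hitSet g
    tail⊂ = (λ i∈ → ∈hitSet⁺ (hits-tail {g = g} (∈hitSet⁻ i∈)))
          , (g zero + toℕ i) mod q
          , ∈hitSet⁺ (hits-cong (≡-mod-sym (toℕ-mod _)) (hits-head {g = g} h))
          , ¬h′ ∘ hits-cong (toℕ-mod _) ∘ ∈hitSet⁻
  ... | no ¬∃ = inj₁ (hits-tail ∘ closed⇒hitsAll (g ∘ suc) (g∤ zero) closed)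
    where
    closed : ∀ r → Hits (g ∘ suc) r → Hits (g ∘ suc) (g zero + r)
    closed r h with hits? (g ∘ suc) (g zero + r)
    ... | yes h′ = h′
    ... | no ¬h′ = contradiction
      ( r mod q
      , hits-cong (≡-mod-sym (toℕ-mod r)) h
      , ¬h′ ∘ hits-cong (+-cong-mod ≡-mod-refl (toℕ-mod r)))
      ¬∃

  subsetSums-cover : ∀ {n} (g : Fin n → ℕ) → (∀ i → ¬ q ∣ g i) → k ≤ n → ∀ r → Hits g r
  subsetSums-cover g g∤ k≤n r with hitSet-grows g g∤
  ... | inj₁ hitsAll = hitsAll r
  ... | inj₂ n<∣hitSet∣ = hits-cong (toℕ-mod r) (∈hitSet⁻ (subst (r mod q ∈_) (sym full) ∈⊤))
    where
    full : hitSet g ≡ ⊤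
    full = ∣p∣≡n⇒p≡⊤ (≤-antisym (∣p∣≤n (hitSet g)) (≤-trans (s≤s k≤n) n<∣hitSet∣))

  module _ (a₀ : ℕ) (g : Fin (k + suc k) → ℕ) (g∤ : ∀ i → ¬ q ∣ g i)
           (squareful : ∀ J → SquarefulAt q (a₀ + subsetSum g J)) where

    private
      x = g ∘ (_↑ˡ suc k)
      w = g ∘ (k ↑ʳ_)
      y = w zero
      z = w ∘ suc

    -- Pick S with a₀ + Σ x S + Σ w J divisible by q; then so is a₀ + Σ x S + Σ w J′,
    -- and both are divisible by q².
    ≡-mod-q⇒≡-mod-q² : ∀ J J′ → subsetSum w J ≡ subsetSum w J′ [mod q ] →
                                 subsetSum w J ≡ subsetSum w J′ [mod q * q ]
    ≡-mod-q⇒≡-mod-q² J J′ u≡u′ with ∃-+-inverse-mod (a₀ + subsetSum w J)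
    ... | e , q∣e+a₀+u with subsetSums-cover x (g∤ ∘ (_↑ˡ suc k)) ≤-refl e
    ... | S , Sx≡e = +-cancelˡ-mod (a₀ + subsetSum x S) (∣∧∣⇒≡-mod (q²∣ J q∣J) (q²∣ J′ q∣J′))
      where
      q²∣ : ∀ J → SquarefulAt q (a₀ + subsetSum x S + subsetSum w J)
      q²∣ J = subst (SquarefulAt q)
        (trans (cong (a₀ +_) (subsetSum-++ g S J)) (sym (+-assoc a₀ (subsetSum x S) _)))
        (squareful (S ++ J))
      rearrange : a₀ + subsetSum x S + subsetSum w J ≡ e + (a₀ + subsetSum w J) [mod q ]
      rearrange = ≡-mod-trans
        (≡⇒≡-mod (trans (cong (_+ subsetSum w J) (+-comm a₀ (subsetSum x S)))
                        (+-assoc (subsetSum x S) a₀ _)))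
        (+-cong-mod Sx≡e ≡-mod-refl)
      q∣J : q ∣ a₀ + subsetSum x S + subsetSum w J
      q∣J = ∣-resp-≡-mod rearrange q∣e+a₀+u
      q∣J′ : q ∣ a₀ + subsetSum x S + subsetSum w J′
      q∣J′ = ∣-resp-≡-mod (+-cong-mod (≡-mod-refl {x = a₀ + subsetSum x S}) (≡-mod-sym u≡u′)) q∣J

    private
      T : ℕ → Subset k
      T r = proj₁ (subsetSums-cover z (g∤ ∘ (k ↑ʳ_) ∘ suc) ≤-refl r)

      F : ℕ → ℕ
      F r = subsetSum z (T r)

      F≡ : ∀ r → F r ≡ r [mod q ]
      F≡ r = proj₂ (subsetSums-cover z (g∤ ∘ (k ↑ʳ_) ∘ suc) ≤-refl r)

    F-shift : ∀ r → F (y + r) ≡ y + F r [mod q * q ]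
    F-shift r = ≡-mod-q⇒≡-mod-q² (false ∷ T (y + r)) (true ∷ T r)
      (≡-mod-trans (F≡ (y + r)) (+-cong-mod (≡-mod-refl {x = y}) (≡-mod-sym (F≡ r))))

    F-multiple : ∀ t → F (t * y) ≡ F 0 + t * y [mod q * q ]
    F-multiple zero = ≡⇒≡-mod (sym (+-identityʳ (F 0)))
    F-multiple (suc t) = begin
      F (y + t * y)        ≈⟨ F-shift (t * y) ⟩
      y + F (t * y)        ≈⟨ +-cong-mod (≡-mod-refl {x = y}) (F-multiple t) ⟩
      y + (F 0 + t * y)    ≡⟨ x∙yz≈y∙xz y (F 0) (t * y) ⟩
      F 0 + (y + t * y)    ∎
      where open ≈-Reasoning (≡-mod-setoid {q * q})

    q∣y : q ∣ y
    q∣y = *-cancelˡ-∣ q (∣-resp-≡-mod qy≡0 ((q * q) ∣0))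
      where
      open ≈-Reasoning (≡-mod-setoid {q * q})
      F[qy]≡F0 : F (q * y) ≡ F 0 [mod q * q ]
      F[qy]≡F0 = ≡-mod-q⇒≡-mod-q² (false ∷ T (q * y)) (false ∷ T 0)
        (≡-mod-trans (F≡ (q * y)) (≡-mod-trans (∣∧∣⇒≡-mod (m∣m*n y) (q ∣0)) (≡-mod-sym (F≡ 0))))
      qy≡0 : q * y ≡ 0 [mod q * q ]
      qy≡0 = +-cancelˡ-mod (F 0) (begin
        F 0 + q * y   ≈⟨ F-multiple q ⟨
        F (q * y)     ≈⟨ F[qy]≡F0 ⟩
        F 0           ≡⟨ +-identityʳ (F 0) ⟨
        F 0 + 0       ∎)

  ¬squarefulAt-cube : ∀ a₀ (g : Fin (k + suc k) → ℕ) → (∀ i → ¬ q ∣ g i) →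
    ¬ (∀ J → SquarefulAt q (a₀ + subsetSum g J))
  ¬squarefulAt-cube a₀ g g∤ squareful = g∤ (k ↑ʳ zero) (q∣y a₀ g g∤ squareful)

  squarefulAt-cube⇒dim≤ : ∀ {m} a₀ (g : Fin m → ℕ) → (∀ i → ¬ q ∣ g i) →
    (∀ J → SquarefulAt q (a₀ + subsetSum g J)) → m ≤ k + k
  squarefulAt-cube⇒dim≤ {m} a₀ g g∤ squareful with m ≤? k + k
  ... | yes m≤2k = m≤2k
  ... | no m≰2k with m≤n⇒∃[o]m+o≡n (subst (_≤ m) (sym (+-suc k k)) (≰⇒> m≰2k))
  ... | o , refl = ⊥-elim (¬squarefulAt-cube a₀ (g ∘ (_↑ˡ o)) (g∤ ∘ (_↑ˡ o))
                     (⊑-cube (SquarefulAt q) a₀ (↑ˡ-⊑ o g) squareful))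

  #nonMultiples≤ : ∀ {d} a₀ (a : Fin d → ℕ) → (∀ I → SquarefulAt q (a₀ + subsetSum a I)) →
    #nonMultiples q a ≤ k + k
  #nonMultiples≤ a₀ a squareful with nonMultiples q a
  ... | g , g∤ , g⊑a = squarefulAt-cube⇒dim≤ a₀ g g∤ (⊑-cube (SquarefulAt q) a₀ g⊑a squareful)

-- Products over primes

∏ : ∀ {d} → (Fin d → ℕ) → ℕ
∏ {zero} f = 1
∏ {suc d} f = f zero * ∏ (f ∘ suc)

∏-mono-≤ : ∀ {d} {f g : Fin d → ℕ} → (∀ i → f i ≤ g i) → ∏ f ≤ ∏ g
∏-mono-≤ {zero} f≤g = ≤-refl
∏-mono-≤ {suc d} f≤g = *-mono-≤ (f≤g zero) (∏-mono-≤ (f≤g ∘ suc))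

∏-* : ∀ {d} (f g : Fin d → ℕ) → ∏ (λ i → f i * g i) ≡ ∏ f * ∏ g
∏-* {zero} f g = refl
∏-* {suc d} f g = trans (cong (f zero * g zero *_) (∏-* (f ∘ suc) (g ∘ suc)))
                        (*-interchange (f zero) (g zero) (∏ (f ∘ suc)) (∏ (g ∘ suc)))

∏-const : ∀ d c → ∏ {d} (λ _ → c) ≡ c ^ d
∏-const zero c = refl
∏-const (suc d) c = cong (c *_) (∏-const d c)

onPrimes : (ℕ → ℕ) → ℕ → ℕ
onPrimes f p = if does (prime? p) then f p else 1

primeProduct : (ℕ → ℕ) → ℕ → ℕ
primeProduct f zero = 1
primeProduct f (suc s) = onPrimes f (suc s) * primeProduct f s

primorial : ℕ → ℕ
primorial = primeProduct (λ p → p)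

onPrimes-* : ∀ f g p → onPrimes (λ r → f r * g r) p ≡ onPrimes f p * onPrimes g p
onPrimes-* f g p with does (prime? p)
... | true  = refl
... | false = refl

onPrimes-mono-≤ : ∀ {f g} p → (Prime p → f p ≤ g p) → onPrimes f p ≤ onPrimes g p
onPrimes-mono-≤ p f≤g with prime? p
... | yes p-prime = f≤g p-prime
... | no _        = ≤-refl

primeProduct-1 : ∀ s → primeProduct (λ _ → 1) s ≡ 1
primeProduct-1 zero = refl
primeProduct-1 (suc s) with does (prime? (suc s))
... | true  = trans (*-identityˡ _) (primeProduct-1 s)
... | false = trans (*-identityˡ _) (primeProduct-1 s)

primeProduct-* : ∀ f g s → primeProduct (λ p → f p * g p) s ≡ primeProduct f s * primeProduct g s
primeProduct-* f g zero = refl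
primeProduct-* f g (suc s) = begin
  onPrimes (λ r → f r * g r) (suc s) * primeProduct (λ p → f p * g p) s
    ≡⟨ cong₂ _*_ (onPrimes-* f g (suc s)) (primeProduct-* f g s) ⟩
  (onPrimes f (suc s) * onPrimes g (suc s)) * (primeProduct f s * primeProduct g s)
    ≡⟨ *-interchange (onPrimes f (suc s)) _ _ _ ⟩
  (onPrimes f (suc s) * primeProduct f s) * (onPrimes g (suc s) * primeProduct g s) ∎
  where open ≡-Reasoning

primeProduct-^ : ∀ f s T → primeProduct (λ p → f p ^ T) s ≡ primeProduct f s ^ T
primeProduct-^ f s zero = primeProduct-1 s
primeProduct-^ f s (suc T) =
  trans (primeProduct-* f (λ p → f p ^ T) s) (cong (primeProduct f s *_) (primeProduct-^ f s T))

primeProduct-mono-≤ : ∀ {f g} s → (∀ p → Prime p → p ≤ s → f p ≤ g p) →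
  primeProduct f s ≤ primeProduct g s
primeProduct-mono-≤ zero f≤g = ≤-refl
primeProduct-mono-≤ {f} {g} (suc s) f≤g =
  *-mono-≤ (onPrimes-mono-≤ {f} {g} (suc s) (λ p-prime → f≤g (suc s) p-prime ≤-refl))
           (primeProduct-mono-≤ s (λ p p-prime p≤s → f≤g p p-prime (m≤n⇒m≤1+n p≤s)))

primeProduct≥1 : ∀ {f} s → (∀ p → Prime p → 1 ≤ f p) → 1 ≤ primeProduct f s
primeProduct≥1 {f} s f≥1 = subst (_≤ primeProduct f s) (primeProduct-1 s)
  (primeProduct-mono-≤ s (λ p p-prime _ → f≥1 p p-prime))

primorial≥1 : ∀ s → 1 ≤ primorial s
primorial≥1 s = primeProduct≥1 s (λ p p-prime → >-nonZero⁻¹ p {{prime⇒nonZero p-prime}})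

primeProduct≤^ : ∀ {f M} s → 1 ≤ M → (∀ p → Prime p → f p ≤ M) → primeProduct f s ≤ M ^ s
primeProduct≤^ zero 1≤M f≤M = ≤-refl
primeProduct≤^ {f} {M} (suc s) 1≤M f≤M = *-mono-≤ onPrimes≤M (primeProduct≤^ s 1≤M f≤M)
  where
  onPrimes≤M : onPrimes f (suc s) ≤ M
  onPrimes≤M with prime? (suc s)
  ... | yes p-prime = f≤M (suc s) p-prime
  ... | no _        = 1≤M

∏-primeProduct : ∀ {d} (h : Fin d → ℕ → ℕ) s →
  ∏ (λ i → primeProduct (h i) s) ≡ primeProduct (λ p → ∏ (λ i → h i p)) s
∏-primeProduct {zero} h s = sym (primeProduct-1 s)
∏-primeProduct {suc d} h s =
  trans (cong (primeProduct (h zero) s *_) (∏-primeProduct (h ∘ suc) s))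
        (sym (primeProduct-* (h zero) (λ p → ∏ (λ i → h (suc i) p)) s))

prime∤primeProduct : ∀ {p f} s → Prime p → s < p → (∀ r → f r ∣ r) →
  ¬ p ∣ primeProduct f s
prime∤primeProduct zero p-prime _ _ p∣1 = ¬prime[1] (subst Prime (∣1⇒≡1 p∣1) p-prime)
prime∤primeProduct {p} {f} (suc s) p-prime s<p f∣ p∣
  with euclidsLemma (onPrimes f (suc s)) (primeProduct f s) p-prime p∣
... | inj₁ p∣factor = >⇒∤ s<p (∣-trans p∣factor onPrimes-∣)
  where
  onPrimes-∣ : onPrimes f (suc s) ∣ suc s
  onPrimes-∣ with does (prime? (suc s))
  ... | true  = f∣ (suc s)
  ... | false = 1∣ suc s
... | inj₂ p∣rest = prime∤primeProduct s p-prime (<-trans (n<1+n s) s<p) f∣ p∣rest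

coprime-∣-* : ∀ {m n x} → Coprime m n → m ∣ x → n ∣ x → m * n ∣ x
coprime-∣-* {m} {n} m⊥n m∣x (divides c x≡cn) = subst (m * n ∣_) (sym x≡cn) (*-monoˡ-∣ n m∣c)
  where
  m∣c : m ∣ c
  m∣c = coprime-divisor m⊥n (subst (m ∣_) (trans x≡cn (*-comm c n)) m∣x)

dividingPart : ℕ → ℕ → ℕ
dividingPart x p = if does (p ∣? x) then p else 1

coprimePart : ℕ → ℕ → ℕ
coprimePart x p = if does (p ∣? x) then 1 else p

dividingPart-∣ : ∀ x p → dividingPart x p ∣ p
dividingPart-∣ x p with does (p ∣? x)
... | true  = ∣-refl
... | false = 1∣ p

dividingPart-*-∣ : ∀ x p {G} → Coprime p G → G ∣ x → dividingPart x p * G ∣ x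
dividingPart-*-∣ x p p⊥G G∣x with p ∣? x
... | yes p∣x = coprime-∣-* p⊥G p∣x G∣x
... | no _    = subst (_∣ x) (sym (*-identityˡ _)) G∣x

primeProduct-dividingPart-∣ : ∀ x s → primeProduct (dividingPart x) s ∣ x
primeProduct-dividingPart-∣ x zero = 1∣ x
primeProduct-dividingPart-∣ x (suc s) with prime? (suc s)
... | yes p-prime =
  dividingPart-*-∣ x (suc s) (prime∤⇒coprime p-prime p∤G) (primeProduct-dividingPart-∣ x s)
  where p∤G = prime∤primeProduct s p-prime ≤-refl (dividingPart-∣ x)
... | no _ = subst (_∣ x) (sym (*-identityˡ _)) (primeProduct-dividingPart-∣ x s)

primorial≤*coprimePart : ∀ s {x} → 1 ≤ x → primorial s ≤ x * primeProduct (coprimePart x) s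
primorial≤*coprimePart s {x} 1≤x = begin
  primorial s
    ≤⟨ primeProduct-mono-≤ s (λ p _ _ → ≤-reflexive (split p)) ⟩
  primeProduct (λ p → dividingPart x p * coprimePart x p) s
    ≡⟨ primeProduct-* (dividingPart x) (coprimePart x) s ⟩
  primeProduct (dividingPart x) s * primeProduct (coprimePart x) s
    ≤⟨ *-monoˡ-≤ _ (∣⇒≤ {{>-nonZero 1≤x}} (primeProduct-dividingPart-∣ x s)) ⟩
  x * primeProduct (coprimePart x) s ∎
  where
  open ≤-Reasoning
  split : ∀ p → p ≡ dividingPart x p * coprimePart x p
  split p with does (p ∣? x)
  ... | true  = sym (*-identityʳ p)
  ... | false = sym (*-identityˡ p)

∏-coprimePart : ∀ {d} p (a : Fin d → ℕ) →
  ∏ (λ i → coprimePart (a i) p) ≡ p ^ #nonMultiples p a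
∏-coprimePart {zero} p a = refl
∏-coprimePart {suc d} p a with p ∣? a zero
... | yes _ = trans (*-identityˡ _) (∏-coprimePart p (a ∘ suc))
... | no _  = cong (p *_) (∏-coprimePart p (a ∘ suc))

primorial^d≤ : ∀ {d} s T N (a : Fin d → ℕ) → (∀ i → 1 ≤ a i) → (∀ i → a i ≤ N) →
  (∀ p → Prime p → p ≤ s → #nonMultiples p a ≤ T) → primorial s ^ d ≤ N ^ d * primorial s ^ T
primorial^d≤ {d} s T N a 1≤a a≤N #a≤T = begin
  primorial s ^ d
    ≡⟨ ∏-const d (primorial s) ⟨
  ∏ {d} (λ _ → primorial s)
    ≤⟨ ∏-mono-≤ (λ i → primorial≤*coprimePart s (1≤a i)) ⟩
  ∏ (λ i → a i * primeProduct (coprimePart (a i)) s)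
    ≡⟨ ∏-* a (λ i → primeProduct (coprimePart (a i)) s) ⟩
  ∏ a * ∏ (λ i → primeProduct (coprimePart (a i)) s)
    ≡⟨ cong (∏ a *_) (∏-primeProduct (λ i → coprimePart (a i)) s) ⟩
  ∏ a * primeProduct (λ p → ∏ (λ i → coprimePart (a i) p)) s
    ≤⟨ *-mono-≤ (∏-mono-≤ a≤N) (primeProduct-mono-≤ s coprimeParts≤) ⟩
  ∏ {d} (λ _ → N) * primeProduct (λ p → p ^ T) s
    ≡⟨ cong₂ _*_ (∏-const d N) (primeProduct-^ (λ p → p) s T) ⟩
  N ^ d * primorial s ^ T ∎
  where
  open ≤-Reasoning
  coprimeParts≤ : ∀ p → Prime p → p ≤ s → ∏ (λ i → coprimePart (a i) p) ≤ p ^ T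
  coprimeParts≤ p p-prime p≤s = begin
    ∏ (λ i → coprimePart (a i) p) ≡⟨ ∏-coprimePart p a ⟩
    p ^ #nonMultiples p a         ≤⟨ ^-monoʳ-≤ p {{prime⇒nonZero p-prime}} (#a≤T p p-prime p≤s) ⟩
    p ^ T                         ∎

^-distribʳ-* : ∀ m n k → (m * n) ^ k ≡ m ^ k * n ^ k
^-distribʳ-* m n zero = refl
^-distribʳ-* m n (suc k) =
  trans (cong (m * n *_) (^-distribʳ-* m n k)) (*-interchange m n (m ^ k) (n ^ k))

^-cancelˡ-≤ : ∀ m {n o} → 1 < m → m ^ n ≤ m ^ o → n ≤ o
^-cancelˡ-≤ m {n} {o} 1<m m^n≤m^o with n ≤? o
... | yes n≤o = n≤o
... | no n≰o  = contradiction m^n≤m^o (<⇒≱ (^-monoʳ-< m 1<m (≰⇒> n≰o)))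

exponent≤ : ∀ {R N} d T → 1 < R → N * N ≤ R → R ^ d ≤ N ^ d * R ^ T → d ≤ T + T
exponent≤ {R} {N} d T 1<R N²≤R R^d≤ = +-cancelˡ-≤ d d (T + T) (^-cancelˡ-≤ R 1<R (begin
  R ^ (d + d)                       ≡⟨ ^-distribˡ-+-* R d d ⟩
  R ^ d * R ^ d                     ≤⟨ *-mono-≤ R^d≤ R^d≤ ⟩
  (N ^ d * R ^ T) * (N ^ d * R ^ T) ≡⟨ *-interchange (N ^ d) (R ^ T) (N ^ d) (R ^ T) ⟩
  (N ^ d * N ^ d) * (R ^ T * R ^ T) ≡⟨ cong₂ _*_ (^-distribʳ-* N N d) (^-distribˡ-+-* R T T) ⟨
  (N * N) ^ d * R ^ (T + T)         ≤⟨ *-monoˡ-≤ (R ^ (T + T)) (^-monoˡ-≤ d N²≤R) ⟩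
  R ^ d * R ^ (T + T)               ≡⟨ ^-distribˡ-+-* R d (T + T) ⟨
  R ^ (d + (T + T))                 ∎))
  where open ≤-Reasoning

dimension≤ : ∀ N M → 2 ≤ N → N * N ≤ primorial M → ∀ d a₀ (a : Fin d → ℕ) →
  (∀ i → 0 < a i) → CubeInSquarefulUpTo N a₀ a → d ≤ 4 * M
dimension≤ N M 2≤N N²≤P d a₀ a 0<a cube = subst (d ≤_) (regroup M)
  (exponent≤ d (M + M) 1<P N²≤P (primorial^d≤ M (M + M) N a 0<a a≤N #nonMultiples≤2M))
  where
  regroup : ∀ M → (M + M) + (M + M) ≡ 4 * M
  regroup = solve-∀
  1<P : 1 < primorial M
  1<P = ≤-trans 2≤N (≤-trans (m≤m*n N N {{>-nonZero (≤-trans (s≤s z≤n) 2≤N)}}) N²≤P)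
  a≤N : ∀ i → a i ≤ N
  a≤N i = ≤-trans (≤-reflexive (sym (subsetSum-⁅⁆ a i)))
                  (≤-trans (m≤n+m _ a₀) (proj₂ (proj₂ (cube ⁅ i ⁆))))
  #nonMultiples≤2M : ∀ p → Prime p → p ≤ M → #nonMultiples p a ≤ M + M
  #nonMultiples≤2M zero p-prime _ = contradiction p-prime ¬prime[0]
  #nonMultiples≤2M (suc k) p-prime 1+k≤M =
    ≤-trans (#nonMultiples≤ p-prime a₀ a (λ I → proj₁ (cube I) (suc k) p-prime)) (+-mono-≤ k≤M k≤M)
    where k≤M = ≤-trans (n≤1+n k) 1+k≤M

-- Chebyshev's lower bound for the primorial

-- binomial a b is the binomial coefficient (a + b choose a).
binomial : ℕ → ℕ → ℕ
binomial zero    b       = 1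
binomial (suc a) zero    = 1
binomial (suc a) (suc b) = binomial a (suc b) + binomial (suc a) b

binomial≥1 : ∀ a b → 1 ≤ binomial a b
binomial≥1 zero    b       = ≤-refl
binomial≥1 (suc a) zero    = ≤-refl
binomial≥1 (suc a) (suc b) = ≤-trans (binomial≥1 a (suc b)) (m≤m+n _ _)

binomial-closed : ∀ a b → binomial a b * (a ! * b !) ≡ (a + b) !
binomial-closed zero b = trans (*-identityˡ _) (*-identityˡ _)
binomial-closed (suc a) zero =
  trans (*-identityˡ _) (trans (*-identityʳ _) (cong _! (sym (+-identityʳ (suc a)))))
binomial-closed (suc a) (suc b) = begin
  (binomial a (suc b) + binomial (suc a) b) * (suc a ! * suc b !)
    ≡⟨ regroup (binomial a (suc b)) (binomial (suc a) b) a b (a !) (b !) ⟩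
  suc a * (binomial a (suc b) * (a ! * suc b !)) + suc b * (binomial (suc a) b * (suc a ! * b !))
    ≡⟨ cong₂ (λ s t → suc a * s + suc b * t) (binomial-closed a (suc b)) (binomial-closed (suc a) b) ⟩
  suc a * (a + suc b) ! + suc b * (suc a + b) !
    ≡⟨ cong (λ n → suc a * n ! + suc b * (suc a + b) !) (+-suc a b) ⟩
  suc a * (suc a + b) ! + suc b * (suc a + b) !
    ≡⟨ *-distribʳ-+ ((suc a + b) !) (suc a) (suc b) ⟨
  (suc a + suc b) * (suc a + b) !
    ≡⟨ cong (λ n → (suc a + suc b) * n !) (+-suc a b) ⟨
  (suc a + suc b) ! ∎
  where
  open ≡-Reasoning
  regroup : ∀ A B a b fa fb → (A + B) * ((suc a * fa) * (suc b * fb)) ≡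
    suc a * (A * (fa * (suc b * fb))) + suc b * (B * ((suc a * fa) * fb))
  regroup = solve-∀

-- The denominators of Leibniz's harmonic triangle: 1 / leibniz a b = ∫₀¹ tᵃ (1 − t)ᵇ dt.
leibniz : ℕ → ℕ → ℕ
leibniz a b = suc (a + b) * binomial a b

leibniz≢0 : ∀ a b → NonZero (leibniz a b)
leibniz≢0 a b = m*n≢0 (suc (a + b)) (binomial a b) {{_}} {{>-nonZero (binomial≥1 a b)}}

leibniz-closed : ∀ a b → leibniz a b * (a ! * b !) ≡ suc (a + b) !
leibniz-closed a b = trans (*-assoc (suc (a + b)) (binomial a b) (a ! * b !))
                           (cong (suc (a + b) *_) (binomial-closed a b))

leibniz-sucˡ : ∀ a b → suc a * leibniz (suc a) b ≡ (suc a + suc b) * leibniz a b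
leibniz-sucˡ a b = *-cancelʳ-≡ _ _ (a ! * b !) {{a !* b !≢0}} (begin
  suc a * leibniz (suc a) b * (a ! * b !)        ≡⟨ regroup (suc a) (leibniz (suc a) b) (a !) (b !) ⟩
  leibniz (suc a) b * (suc a ! * b !)            ≡⟨ leibniz-closed (suc a) b ⟩
  suc (suc (a + b)) !                            ≡⟨ cong (_* suc (a + b) !) (cong suc (+-suc a b)) ⟨
  (suc a + suc b) * suc (a + b) !                ≡⟨ cong ((suc a + suc b) *_) (leibniz-closed a b) ⟨
  (suc a + suc b) * (leibniz a b * (a ! * b !))  ≡⟨ *-assoc (suc a + suc b) (leibniz a b) (a ! * b !) ⟨
  (suc a + suc b) * leibniz a b * (a ! * b !)    ∎)
  where
  open ≡-Reasoning
  regroup : ∀ a′ l fa fb → a′ * l * (fa * fb) ≡ l * ((a′ * fa) * fb)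
  regroup = solve-∀

leibniz-sucʳ : ∀ a b → suc b * leibniz a (suc b) ≡ (suc a + suc b) * leibniz a b
leibniz-sucʳ a b = *-cancelʳ-≡ _ _ (a ! * b !) {{a !* b !≢0}} (begin
  suc b * leibniz a (suc b) * (a ! * b !)        ≡⟨ regroup (suc b) (leibniz a (suc b)) (a !) (b !) ⟩
  leibniz a (suc b) * (a ! * suc b !)            ≡⟨ leibniz-closed a (suc b) ⟩
  suc (a + suc b) !                              ≡⟨ cong (λ n → suc n !) (+-suc a b) ⟩
  suc (suc (a + b)) !                            ≡⟨ cong (_* suc (a + b) !) (cong suc (+-suc a b)) ⟨
  (suc a + suc b) * suc (a + b) !                ≡⟨ cong ((suc a + suc b) *_) (leibniz-closed a b) ⟨
  (suc a + suc b) * (leibniz a b * (a ! * b !))  ≡⟨ *-assoc (suc a + suc b) (leibniz a b) (a ! * b !) ⟨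
  (suc a + suc b) * leibniz a b * (a ! * b !)    ∎)
  where
  open ≡-Reasoning
  regroup : ∀ b′ l fa fb → b′ * l * (fa * fb) ≡ l * (fa * (b′ * fb))
  regroup = solve-∀

-- X * Y + Z * X ≡ Z * Y is 1 / Z = 1 / X − 1 / Y with the denominators cleared.
harmonic : ∀ X Y Z α β .{{_ : NonZero α}} .{{_ : NonZero β}} →
  α * Z ≡ (α + β) * X → β * Y ≡ (α + β) * X → X * Y + Z * X ≡ Z * Y
harmonic X Y Z α β αZ≡cX βY≡cX = *-cancelʳ-≡ _ _ (α * β) {{m*n≢0 α β}} (begin
  (X * Y + Z * X) * (α * β)           ≡⟨ regroup X Y Z α β ⟩
  X * (β * Y) * α + (α * Z) * X * β   ≡⟨ cong₂ (λ s t → X * s * α + t * X * β) βY≡cX αZ≡cX ⟩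
  X * (c * X) * α + (c * X) * X * β   ≡⟨ sum-square X α β ⟩
  (c * X) * (c * X)                   ≡⟨ cong₂ _*_ αZ≡cX βY≡cX ⟨
  (α * Z) * (β * Y)                   ≡⟨ regroup′ Y Z α β ⟩
  Z * Y * (α * β)                     ∎)
  where
  open ≡-Reasoning
  c = α + β
  regroup : ∀ X Y Z α β → (X * Y + Z * X) * (α * β) ≡ X * (β * Y) * α + (α * Z) * X * β
  regroup = solve-∀
  sum-square : ∀ X α β →
    X * ((α + β) * X) * α + ((α + β) * X) * X * β ≡ ((α + β) * X) * ((α + β) * X)
  sum-square = solve-∀
  regroup′ : ∀ Y Z α β → (α * Z) * (β * Y) ≡ Z * Y * (α * β)
  regroup′ = solve-∀

harmonic-∣ : ∀ {X Y Z m} .{{_ : NonZero X}} .{{_ : NonZero Y}} → X * Y + Z * X ≡ Z * Y →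
  X ∣ m → Y ∣ m → Z ∣ m
harmonic-∣ {X} {Y} {Z} {m} XY+ZX≡ZY (divides u m≡uX) (divides v m≡vY) =
  ∣m+n∣m⇒∣n (subst (Z ∣_) (sym vZ+m≡uZ) (n∣m*n u)) (n∣m*n v)
  where
  open ≡-Reasoning
  vZ+m≡uZ : v * Z + m ≡ u * Z
  vZ+m≡uZ = *-cancelʳ-≡ _ _ (X * Y) {{m*n≢0 X Y}} (begin
    (v * Z + m) * (X * Y)           ≡⟨ regroup v Z m X Y ⟩
    v * Y * Z * X + m * (X * Y)     ≡⟨ cong (λ t → t * Z * X + m * (X * Y)) m≡vY ⟨
    m * Z * X + m * (X * Y)         ≡⟨ factor m X Y Z ⟩
    m * (X * Y + Z * X)             ≡⟨ cong (m *_) XY+ZX≡ZY ⟩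
    m * (Z * Y)                     ≡⟨ cong (_* (Z * Y)) m≡uX ⟩
    u * X * (Z * Y)                 ≡⟨ regroup′ u X Y Z ⟩
    u * Z * (X * Y)                 ∎)
    where
    regroup : ∀ v Z m X Y → (v * Z + m) * (X * Y) ≡ v * Y * Z * X + m * (X * Y)
    regroup = solve-∀
    factor : ∀ m X Y Z → m * Z * X + m * (X * Y) ≡ m * (X * Y + Z * X)
    factor = solve-∀
    regroup′ : ∀ u X Y Z → u * X * (Z * Y) ≡ u * Z * (X * Y)
    regroup′ = solve-∀

leibniz-∣ : ∀ a b m → (∀ j → 1 ≤ j → j ≤ suc (a + b) → j ∣ m) → leibniz a b ∣ m
leibniz-∣ zero b m ∣m = subst (_∣ m) (sym (*-identityʳ (suc b))) (∣m (suc b) (s≤s z≤n) ≤-refl)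
leibniz-∣ (suc a) b m ∣m = harmonic-∣ {{leibniz≢0 a b}} {{leibniz≢0 a (suc b)}}
  (harmonic _ _ _ (suc a) (suc b) (leibniz-sucˡ a b) (leibniz-sucʳ a b))
  (leibniz-∣ a b m (λ j 1≤j j≤ → ∣m j 1≤j (m≤n⇒m≤1+n j≤)))
  (leibniz-∣ a (suc b) m (λ j 1≤j j≤ → ∣m j 1≤j (≤-trans j≤ (≤-reflexive (cong suc (+-suc a b))))))

2^k≤leibniz : ∀ k → 2 ^ k ≤ leibniz k k
2^k≤leibniz zero = s≤s z≤n
2^k≤leibniz (suc k) = begin
  2 * 2 ^ k                 ≤⟨ *-monoʳ-≤ 2 (2^k≤leibniz k) ⟩
  2 * leibniz k k           ≡⟨ leibniz-double ⟨
  leibniz (suc k) k         ≤⟨ *-cancelˡ-≤ (suc k) (begin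
    suc k * leibniz (suc k) k                 ≤⟨ *-monoˡ-≤ _ (m≤n+m (suc k) (suc (suc k))) ⟩
    (suc (suc k) + suc k) * leibniz (suc k) k ≡⟨ leibniz-sucʳ (suc k) k ⟨
    suc k * leibniz (suc k) (suc k)           ∎) ⟩
  leibniz (suc k) (suc k)   ∎
  where
  open ≤-Reasoning
  double : ∀ n x → (n + n) * x ≡ n * (2 * x)
  double = solve-∀
  leibniz-double : leibniz (suc k) k ≡ 2 * leibniz k k
  leibniz-double = *-cancelˡ-≡ _ _ (suc k) (trans (leibniz-sucˡ k k) (double (suc k) (leibniz k k)))

2^k≤commonMultiple : ∀ k m .{{_ : NonZero m}} →
  (∀ j → 1 ≤ j → j ≤ suc (k + k) → j ∣ m) → 2 ^ k ≤ m
2^k≤commonMultiple k m ∣m = ≤-trans (2^k≤leibniz k) (∣⇒≤ (leibniz-∣ k k m ∣m))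

∃-prime-factor : ∀ n → 1 < n → ∃ λ p → Prime p × p ∣ n
∃-prime-factor 1 (s≤s ())
∃-prime-factor n@(suc (suc _)) _ with factorise n
... | record { factors = [] ; isFactorisation = () }
... | record { factors = p ∷ ps ; isFactorisation = n≡ ; factorsPrime = p-prime ∷ _ } =
  p , p-prime , subst (p ∣_) (sym n≡) (m∣m*n (product ps))

p-adic : ∀ p .{{_ : NonTrivial p}} j .{{_ : NonZero j}} →
  ∃ λ a → ∃ λ r → j ≡ p ^ a * r × ¬ p ∣ r
p-adic p j = <-rec P step j
  where
  P : ℕ → Set
  P j = .{{NonZero j}} → ∃ λ a → ∃ λ r → j ≡ p ^ a * r × ¬ p ∣ r
  step : ∀ j → (∀ {i} → i < j → P i) → P j
  step j rec with p ∣? j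
  ... | no p∤j = 0 , j , sym (*-identityˡ j) , p∤j
  ... | yes p∣j with rec (quotient-< p∣j) {{quotient≢0 p∣j}}
  ... | a , r , c≡ , p∤r = suc a , r , j≡ , p∤r
    where
    j≡ : j ≡ p ^ suc a * r
    j≡ = begin
      j                 ≡⟨ m∣n⇒n≡quotient*m p∣j ⟩
      quotient p∣j * p  ≡⟨ cong (_* p) c≡ ⟩
      p ^ a * r * p     ≡⟨ regroup (p ^ a) r p ⟩
      p * p ^ a * r     ∎
      where
      open ≡-Reasoning
      regroup : ∀ x r p → x * r * p ≡ p * x * r
      regroup = solve-∀

largestPower : ℕ → ℕ → ℕ → ℕ
largestPower p M zero = 1
largestPower p M (suc e) with p ^ suc e ≤? M
... | yes _ = p ^ suc e
... | no _  = largestPower p M e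

^∣largestPower : ∀ p M e a → p ^ a ≤ M → a ≤ e → p ^ a ∣ largestPower p M e
^∣largestPower p M zero zero _ _ = ∣-refl
^∣largestPower p M (suc e) a p^a≤M a≤1+e with p ^ suc e ≤? M
... | yes _ = divides (p ^ (suc e ∸ a))
                (trans (cong (p ^_) (sym (m∸n+n≡m a≤1+e))) (^-distribˡ-+-* p (suc e ∸ a) a))
... | no p^[1+e]≰M with a ≟ suc e
...   | yes refl = contradiction p^a≤M p^[1+e]≰M
...   | no a≢1+e = ^∣largestPower p M e a p^a≤M (≤-pred (≤∧≢⇒< a≤1+e a≢1+e))

largestPower≥1 : ∀ p M e .{{_ : NonZero p}} → 1 ≤ largestPower p M e
largestPower≥1 p M zero = ≤-refl
largestPower≥1 p M (suc e) with p ^ suc e ≤? M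
... | yes _ = m^n>0 p (suc e)
... | no _  = largestPower≥1 p M e

largestPower≤ : ∀ p M e → 1 ≤ M → largestPower p M e ≤ M
largestPower≤ p M zero 1≤M = 1≤M
largestPower≤ p M (suc e) 1≤M with p ^ suc e ≤? M
... | yes p^[1+e]≤M = p^[1+e]≤M
... | no _          = largestPower≤ p M e 1≤M

largestPower≤p : ∀ p M e .{{_ : NonZero p}} → M < p * p → largestPower p M e ≤ p
largestPower≤p p M zero M<p² = >-nonZero⁻¹ p
largestPower≤p p M (suc e) M<p² with p ^ suc e ≤? M
... | no _ = largestPower≤p p M e M<p²
largestPower≤p p M (suc zero) M<p² | yes _ = ≤-reflexive (*-identityʳ p)
largestPower≤p p M (suc (suc e)) M<p² | yes p^[2+e]≤M = contradiction (begin
  p * p                 ≤⟨ *-monoʳ-≤ p (m≤m*n p (p ^ e) {{m^n≢0 p e}}) ⟩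
  p * (p * p ^ e)       ≤⟨ p^[2+e]≤M ⟩
  M                     ∎) (<⇒≱ M<p²)
  where open ≤-Reasoning

Smooth : ℕ → ℕ → Set
Smooth s j = ∀ p → Prime p → p ∣ j → p ≤ s

smooth-pred : ∀ {s j} → Smooth (suc s) j → (Prime (suc s) → ¬ suc s ∣ j) → Smooth s j
smooth-pred {s} smooth ¬1+s∣j p p-prime p∣j with p ≟ suc s
... | yes refl = contradiction p∣j (¬1+s∣j p-prime)
... | no p≢1+s = ≤-pred (≤∧≢⇒< (smooth p p-prime p∣j) p≢1+s)

-- smoothLcm M s is the lcm of the s-smooth numbers up to M; smoothLcm M M = lcm (1, …, M).
smoothLcm : ℕ → ℕ → ℕ
smoothLcm M = primeProduct (λ p → largestPower p M ⌊log₂ M ⌋)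

smooth-∣-smoothLcm : ∀ M s j .{{_ : NonZero j}} → j ≤ M → Smooth s j → j ∣ smoothLcm M s
smooth-∣-smoothLcm M zero 1 _ _ = ∣-refl
smooth-∣-smoothLcm M zero j@(suc (suc _)) _ smooth with ∃-prime-factor j (s≤s (s≤s z≤n))
... | p , p-prime , p∣j =
  contradiction (n≤0⇒n≡0 (smooth p p-prime p∣j)) (≢-nonZero⁻¹ p {{prime⇒nonZero p-prime}})
smooth-∣-smoothLcm M (suc s) j j≤M smooth with prime? (suc s)
... | no ¬prime = ∣n⇒∣m*n 1
  (smooth-∣-smoothLcm M s j j≤M (smooth-pred smooth (λ p-prime _ → ¬prime p-prime)))
... | yes p-prime with p-adic (suc s) {{prime⇒nonTrivial p-prime}} j
... | a , r , j≡ , p∤r = subst (_∣ _) (sym j≡) (*-pres-∣ p^a∣ r∣)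
  where
  p = suc s
  r∣j : r ∣ j
  r∣j = divides (p ^ a) j≡
  instance
    _ = ≢-nonZero (λ r≡0 → ≢-nonZero⁻¹ j (trans j≡ (trans (cong (p ^ a *_) r≡0) (*-zeroʳ (p ^ a)))))
  p^a≤M : p ^ a ≤ M
  p^a≤M = ≤-trans (∣⇒≤ (divides r (trans j≡ (*-comm (p ^ a) r)))) j≤M
  a≤log₂M : a ≤ ⌊log₂ M ⌋
  a≤log₂M = begin
    a               ≡⟨ ⌊log₂[2^n]⌋≡n a ⟨
    ⌊log₂ (2 ^ a) ⌋ ≤⟨ ⌊log₂⌋-mono-≤ (≤-trans (^-monoˡ-≤ a 2≤p) p^a≤M) ⟩
    ⌊log₂ M ⌋       ∎
    where
    open ≤-Reasoning
    2≤p = nonTrivial⇒n>1 p {{prime⇒nonTrivial p-prime}}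
  p^a∣ : p ^ a ∣ largestPower p M ⌊log₂ M ⌋
  p^a∣ = ^∣largestPower p M ⌊log₂ M ⌋ a p^a≤M a≤log₂M
  r∣ : r ∣ smoothLcm M s
  r∣ = smooth-∣-smoothLcm M s r (≤-trans (∣⇒≤ r∣j) j≤M)
         (smooth-pred (λ q q-prime q∣r → smooth q q-prime (∣-trans q∣r r∣j)) (λ _ → p∤r))

-- Primes above B contribute only their first power.
smoothLcm≤ : ∀ M B → 1 ≤ M → M < suc B * suc B →
  ∀ t → smoothLcm M (t + B) ≤ primorial (t + B) * M ^ B
smoothLcm≤ M B 1≤M M<[1+B]² zero = begin
  smoothLcm M B            ≤⟨ primeProduct≤^ B 1≤M (λ p _ → largestPower≤ p M ⌊log₂ M ⌋ 1≤M) ⟩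
  M ^ B                    ≤⟨ m≤n*m (M ^ B) (primorial B) {{>-nonZero (primorial≥1 B)}} ⟩
  primorial B * M ^ B      ∎
  where open ≤-Reasoning
smoothLcm≤ M B 1≤M M<[1+B]² (suc t) = begin
  onPrimes maxPower p * smoothLcm M (t + B)
    ≤⟨ *-mono-≤ (onPrimes-mono-≤ {maxPower} {λ p → p} p (λ _ → largestPower≤p p M ⌊log₂ M ⌋ M<p²))
                (smoothLcm≤ M B 1≤M M<[1+B]² t) ⟩
  onPrimes (λ p → p) p * (primorial (t + B) * M ^ B)
    ≡⟨ *-assoc (onPrimes (λ p → p) p) (primorial (t + B)) (M ^ B) ⟨
  primorial p * M ^ B ∎
  where
  open ≤-Reasoning
  maxPower = λ p → largestPower p M ⌊log₂ M ⌋
  p = suc (t + B)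
  M<p² : M < p * p
  M<p² = <-≤-trans M<[1+B]² (*-mono-≤ (s≤s (m≤n+m B t)) (s≤s (m≤n+m B t)))

chebyshev-numeric : ∀ v → suc (2 * (6 + v) * 2 ^ (6 + v) * 2) ≤ 4 ^ (5 + v) * 2
chebyshev-numeric zero = m≤m+n 1537 511
chebyshev-numeric (suc v) = begin
  suc (2 * (7 + v) * (2 * X) * 2)                         ≤⟨ m≤m+n _ (8 * (5 + v) * X + 3) ⟩
  suc (2 * (7 + v) * (2 * X) * 2) + (8 * (5 + v) * X + 3) ≡⟨ regroup v X ⟩
  4 * suc (2 * (6 + v) * X * 2)                           ≤⟨ *-monoʳ-≤ 4 (chebyshev-numeric v) ⟩
  4 * (4 ^ (5 + v) * 2)                                   ≡⟨ *-assoc 4 (4 ^ (5 + v)) 2 ⟨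
  4 ^ (6 + v) * 2                                         ∎
  where
  open ≤-Reasoning
  X = 2 ^ (6 + v)
  regroup : ∀ v X →
    suc (2 * (7 + v) * (2 * X) * 2) + (8 * (5 + v) * X + 3) ≡ 4 * suc (2 * (6 + v) * X * 2)
  regroup = solve-∀

-- With M = 4 ^ w = B * B: 2 ^ (A + e) ≤ lcm (1, …, M) ≤ primorial M * M ^ B = primorial M * 2 ^ e.
primorial-lower : ∀ v → 2 ^ (4 ^ (5 + v)) ≤ primorial (4 ^ (6 + v))
primorial-lower v = *-cancelʳ-≤ (2 ^ A) (primorial M) (2 ^ e) {{m^n≢0 2 e}} (begin
  2 ^ A * 2 ^ e                  ≡⟨ ^-distribˡ-+-* 2 A e ⟨
  2 ^ k                          ≤⟨ 2^k≤commonMultiple k (smoothLcm M M) ∣smoothLcm ⟩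
  smoothLcm M M                  ≡⟨ cong (smoothLcm M) (m∸n+n≡m B≤M) ⟨
  smoothLcm M (M ∸ B + B)        ≤⟨ smoothLcm≤ M B (m^n>0 4 w) M<[1+B]² (M ∸ B) ⟩
  primorial (M ∸ B + B) * M ^ B  ≡⟨ cong₂ (λ s t → primorial s * t) (m∸n+n≡m B≤M) M^B≡2^e ⟩
  primorial M * 2 ^ e            ∎)
  where
  open ≤-Reasoning
  w = 6 + v
  B = 2 ^ w
  M = 4 ^ w
  A = 4 ^ (5 + v)
  e = 2 * w * B
  k = A + e
  M≡2^[2w] : M ≡ 2 ^ (2 * w)
  M≡2^[2w] = ^-*-assoc 2 2 w
  M≡B*B : M ≡ B * B
  M≡B*B = trans M≡2^[2w] (trans (cong (2 ^_) (cong (w +_) (+-identityʳ w))) (^-distribˡ-+-* 2 w w))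
  M^B≡2^e : M ^ B ≡ 2 ^ e
  M^B≡2^e = trans (cong (_^ B) M≡2^[2w]) (^-*-assoc 2 (2 * w) B)
  B≤M : B ≤ M
  B≤M = subst (B ≤_) (sym M≡B*B) (m≤m*n B B {{m^n≢0 2 w}})
  M<[1+B]² : M < suc B * suc B
  M<[1+B]² = subst (_< suc B * suc B) (sym M≡B*B) (*-mono-< (n<1+n B) (n<1+n B))
  2k+1≤M : suc (k + k) ≤ M
  2k+1≤M = begin
    suc (k + k)            ≡⟨ regroup A e ⟩
    (A + A) + suc (e * 2)  ≤⟨ +-monoʳ-≤ (A + A) (chebyshev-numeric v) ⟩
    (A + A) + A * 2        ≡⟨ regroup′ A ⟩
    4 * A                  ∎
    where
    regroup : ∀ A e → suc ((A + e) + (A + e)) ≡ (A + A) + suc (e * 2)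
    regroup = solve-∀
    regroup′ : ∀ A → (A + A) + A * 2 ≡ 4 * A
    regroup′ = solve-∀
  instance
    smoothLcm≢0 : NonZero (smoothLcm M M)
    smoothLcm≢0 = >-nonZero (primeProduct≥1 M (λ p p-prime →
      largestPower≥1 p M ⌊log₂ M ⌋ {{prime⇒nonZero p-prime}}))
  ∣smoothLcm : ∀ j → 1 ≤ j → j ≤ suc (k + k) → j ∣ smoothLcm M M
  ∣smoothLcm j 1≤j j≤2k+1 = smooth-∣-smoothLcm M M j j≤M (λ p _ p∣j → ≤-trans (∣⇒≤ p∣j) j≤M)
    where
    instance _ = >-nonZero 1≤j
    j≤M = ≤-trans j≤2k+1 2k+1≤M

∃-4^-bracket : ∀ L → 1 ≤ L → ∃ λ u → 4 ^ u ≤ L × L < 4 ^ suc u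
∃-4^-bracket (suc zero) _ = 0 , ≤-refl , s≤s (s≤s z≤n)
∃-4^-bracket (suc (suc l)) _ with ∃-4^-bracket (suc l) (s≤s z≤n)
... | u , 4^u≤1+l , 1+l<4^[1+u] with suc (suc l) <? 4 ^ suc u
... | yes 2+l<4^[1+u] = u , m≤n⇒m≤1+n 4^u≤1+l , 2+l<4^[1+u]
... | no 2+l≮4^[1+u] = suc u , ≤-reflexive 4^[1+u]≡2+l , subst (_< 4 ^ suc (suc u)) 4^[1+u]≡2+l
                         (^-monoʳ-< 4 (s≤s (s≤s z≤n)) (n<1+n (suc u)))
  where
  4^[1+u]≡2+l : 4 ^ suc u ≡ suc (suc l)
  4^[1+u]≡2+l = ≤-antisym (≮⇒≥ 2+l≮4^[1+u]) 1+l<4^[1+u]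

n<2^[1+⌊log₂n⌋] : ∀ n → n < 2 ^ suc ⌊log₂ n ⌋
n<2^[1+⌊log₂n⌋] n with n <? 2 ^ suc ⌊log₂ n ⌋
... | yes n<2^[1+log₂n] = n<2^[1+log₂n]
... | no n≮2^[1+log₂n] = contradiction (⌊log₂⌋-mono-≤ (≮⇒≥ n≮2^[1+log₂n]))
  (subst (λ m → ¬ m ≤ ⌊log₂ n ⌋) (sym (⌊log₂[2^n]⌋≡n (suc ⌊log₂ n ⌋))) 1+n≰n)

square≤primorial : ∀ N → 2 ≤ N → ∃ λ M → M ≤ 4096 * ⌊log₂ N ⌋ × N * N ≤ primorial M
square≤primorial N 2≤N with ∃-4^-bracket ⌊log₂ N ⌋ (⌊log₂⌋-mono-≤ 2≤N)
... | u , 4^u≤L , L<4^[1+u] = 4 ^ (6 + u) , M≤4096L , N²≤primorial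
  where
  open ≤-Reasoning
  L = ⌊log₂ N ⌋
  M≤4096L : 4 ^ (6 + u) ≤ 4096 * L
  M≤4096L = ≤-trans (≤-reflexive (regroup (4 ^ u))) (*-monoʳ-≤ 4096 4^u≤L)
    where
    regroup : ∀ x → 4 * (4 * (4 * (4 * (4 * (4 * x))))) ≡ 4096 * x
    regroup = solve-∀
  double≤ : ∀ x → x + x ≤ 4 * (4 * (4 * (4 * x)))
  double≤ x = ≤-trans (m≤m+n (x + x) (254 * x)) (≤-reflexive (regroup x))
    where
    regroup : ∀ x → x + x + 254 * x ≡ 4 * (4 * (4 * (4 * x)))
    regroup = solve-∀
  N²≤primorial : N * N ≤ primorial (4 ^ (6 + u))
  N²≤primorial = begin
    N * N                    ≤⟨ *-mono-≤ N≤2^[1+L] N≤2^[1+L] ⟩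
    2 ^ suc L * 2 ^ suc L    ≡⟨ ^-distribˡ-+-* 2 (suc L) (suc L) ⟨
    2 ^ (suc L + suc L)      ≤⟨ ^-monoʳ-≤ 2 2+2L≤4^[5+u] ⟩
    2 ^ (4 ^ (5 + u))        ≤⟨ primorial-lower u ⟩
    primorial (4 ^ (6 + u))  ∎
    where
    N≤2^[1+L] = <⇒≤ (n<2^[1+⌊log₂n⌋] N)
    2+2L≤4^[5+u] = ≤-trans (+-mono-≤ L<4^[1+u] L<4^[1+u]) (double≤ (4 ^ suc u))

corollary1p6 : Σ ℕ λ C → Σ ℕ λ N₀ → ∀ N → N₀ ≤ N →
    ∀ d (a₀ : ℕ) (a : Fin d → ℕ) → (∀ i → 0 < a i) →
    CubeInSquarefulUpTo N a₀ a → d ≤ C * ⌊log₂ N ⌋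
corollary1p6 = 16384 , 2 , λ N 2≤N d a₀ a 0<a cube →
  let M , M≤4096L , N²≤P = square≤primorial N 2≤N
  in begin
    d                       ≤⟨ dimension≤ N M 2≤N N²≤P d a₀ a 0<a cube ⟩
    4 * M                   ≤⟨ *-monoʳ-≤ 4 M≤4096L ⟩
    4 * (4096 * ⌊log₂ N ⌋)  ≡⟨ *-assoc 4 4096 ⌊log₂ N ⌋ ⟨
    16384 * ⌊log₂ N ⌋       ∎
  where open ≤-Reasoning
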